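{- Let $\mathcal{C}$ be a full comprehension category satisfying condition (LF). If $\mathcal{C}$ has weakly stable unit types, then the split comprehension category $\mathcal{C}_!$ has strictly stable unit types.
   Context: A full comprehension category $\mathcal{C}=(\mathcal{C},\mathcal{T},p,\chi)$: a category $\mathcal{C}$, a cloven Grothendieck fibration $p:\mathcal{T}\to\mathcal{C}$, a fully faithful functor $\chi:\mathcal{T}\to\mathcal{C}^{\to}$ with $\mathrm{cod}\circ\chi=p$ sending cartesian arrows to pullback squares; split if the cleaving is strictly functorial. For $A\in\mathcal{T}(\Gamma)$, $\chi(A):\Gamma.A\to\Gamma$; display maps are composites of these. For $\sigma:\Delta\to\Gamma$, $A[\sigma]$ is the cleaving's reindexing, $\sigma.A:\Delta.A[\sigma]\to\Gamma.A$; $f[\sigma]$ the induced reindexing of a map. A section of $A$ is a section of $\chi(A)$. Condition (LF): $\mathcal{C}$ has finite products, and for all $Z\xrightarrow{g}Y\xrightarrow{f}X$ with $f$ a display map and $g$ a display map or product projection, a dependent exponential exists (an object $\prod[f,g]$ of $\mathcal{C}/X$ with $\mathcal{C}/X(W,\prod[f,g])\cong\mathcal{C}/Y(W\times_XY,Z)$ naturally in $W\to X$). $\mathcal{C}_!$: same base; objects of $\mathcal{T}_!$ over $\Gamma$ are triples $A=(V_A,E_A,n_A)$, $V_A\in\mathcal{C}$, $E_A\in\mathcal{T}(V_A)$, $n_A:\Gamma\to V_A$, with $[A]:=E_A[n_A]$; morphisms $B\to A$ over $\sigma$ are morphisms $[B]\to[A]$ over $\sigma$ in $\mathcal{T}$;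 $(V_A,E_A,n_A)[\sigma]:=(V_A,E_A,n_A\circ\sigma)$ with the canonical cartesian map; $\chi_!(A):=\chi([A])$. Unit type over $\Gamma$: a type $1\in\mathcal{T}(\Gamma)$, a section $\mathrm{tt}:\Gamma\to\Gamma.1$, and for every $C\in\mathcal{T}(\Gamma.1)$ and section $d$ of $C[\mathrm{tt}]$ a section $\mathrm{urec}_{C,d}$ of $C$ such that $\mathrm{urec}_{C,d}\circ\mathrm{tt}=(\mathrm{tt}.C)\circ d$. Weakly stable unit types: for each $\Gamma$ there is $(1,\mathrm{tt})$ such that for every $\sigma:\Delta\to\Gamma$ elimination sections can be chosen making $(1[\sigma],\mathrm{tt}[\sigma])$ a unit type over $\Delta$. Strictly stable unit types (split case): functions giving $1_\Gamma,\mathrm{tt}_\Gamma$ and $\mathrm{urec}_{C,d}$, all commuting strictly with reindexing. -}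

module Defs where

open import Level using (Level; _⊔_) renaming (suc to lsuc)
open import Relation.Binary.PropositionalEquality using (_≡_; refl; sym; trans; cong; subst; module ≡-Reasoning)
open import Data.Product using (Σ; Σ-syntax; _×_; _,_; proj₁; proj₂)
open import Data.Sum using (_⊎_)
open import Data.Unit using (⊤)
open import Function.Bundles using (_↔_; Inverse)

UniqueΣ : ∀ {a b} {A : Set a} (P : A → Set b) → Set (a ⊔ b)
UniqueΣ {A = A} P = Σ[ x ∈ A ] (P x × (∀ y → P y → x ≡ y))

unique-eq : ∀ {a b} {A : Set a} {P : A → Set b} → UniqueΣ P → ∀ {x y} → P x → P y → x ≡ y
unique-eq (c , _ , u) px py = trans (sym (u _ px)) (u _ py)

record Category (o h : Level) : Set (lsuc (o ⊔ h)) where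
  infixr 9 _∘_
  field
    Obj   : Set o
    Hom   : Obj → Obj → Set h
    id    : ∀ {X} → Hom X X
    _∘_   : ∀ {X Y Z} → Hom Y Z → Hom X Y → Hom X Z
    idˡ   : ∀ {X Y} (f : Hom X Y) → id ∘ f ≡ f
    idʳ   : ∀ {X Y} (f : Hom X Y) → f ∘ id ≡ f
    assoc : ∀ {W X Y Z} (f : Hom Y Z) (g : Hom X Y) (k : Hom W X) → (f ∘ g) ∘ k ≡ f ∘ (g ∘ k)

  record IsPullback {P X Y Z : Obj} (p₁ : Hom P X) (p₂ : Hom P Y) (f : Hom X Z) (g : Hom Y Z) : Set (o ⊔ h) where
    field
      commute   : f ∘ p₁ ≡ g ∘ p₂
      universal : ∀ {W} (a : Hom W X) (b : Hom W Y) → f ∘ a ≡ g ∘ b →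
                  UniqueΣ (λ (u : Hom W P) → (p₁ ∘ u ≡ a) × (p₂ ∘ u ≡ b))

  IsProduct : ∀ {P X Y} → Hom P X → Hom P Y → Set (o ⊔ h)
  IsProduct {P} {X} {Y} p₁ p₂ = ∀ {W} (a : Hom W X) (b : Hom W Y) →
    UniqueΣ (λ (u : Hom W P) → (p₁ ∘ u ≡ a) × (p₂ ∘ u ≡ b))

  IsTerminal : Obj → Set (o ⊔ h)
  IsTerminal T = ∀ X → UniqueΣ (λ (u : Hom X T) → ⊤)

  record FiniteProducts : Set (o ⊔ h) where
    field
      terminal    : Obj
      terminal-is : IsTerminal terminal
      _×ₒ_        : Obj → Obj → Obj
      π₁          : ∀ {X Y} → Hom (X ×ₒ Y) X
      π₂          : ∀ {X Y} → Hom (X ×ₒ Y) Y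
      product-is  : ∀ {X Y} → IsProduct (π₁ {X} {Y}) (π₂ {X} {Y})

  paste : ∀ {P Q W X Y Z} {l₁ : Hom P Q} {l₂ : Hom P W} {r₁ : Hom Q X} {r₂ : Hom Q Y}
            {f : Hom X Z} {g : Hom Y Z} {k : Hom W Y} {o₁ : Hom P X} →
          IsPullback r₁ r₂ f g → r₂ ∘ l₁ ≡ k ∘ l₂ → o₁ ≡ r₁ ∘ l₁ →
          IsPullback o₁ l₂ f (g ∘ k) → IsPullback l₁ l₂ r₂ k
  paste {l₁ = l₁} {l₂} {r₁} {r₂} {f} {g} {k} {o₁} R c eo O = record
    { commute = c ; universal = univ }
    where
    univ : ∀ {V} (a : Hom V _) (b : Hom V _) → r₂ ∘ a ≡ k ∘ b → UniqueΣ (λ u → (l₁ ∘ u ≡ a) × (l₂ ∘ u ≡ b))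
    univ a b e = u , (l₁u≡a , eb) , uniq
      where
      open ≡-Reasoning
      eR : f ∘ (r₁ ∘ a) ≡ g ∘ (r₂ ∘ a)
      eR = trans (sym (assoc f r₁ a)) (trans (cong (_∘ a) (IsPullback.commute R)) (assoc g r₂ a))
      e' : f ∘ (r₁ ∘ a) ≡ (g ∘ k) ∘ b
      e' = trans eR (trans (cong (g ∘_) e) (sym (assoc g k b)))
      UO = IsPullback.universal O (r₁ ∘ a) b e'
      u = proj₁ UO
      eO : o₁ ∘ u ≡ r₁ ∘ a
      eO = proj₁ (proj₁ (proj₂ UO))
      eb : l₂ ∘ u ≡ b
      eb = proj₂ (proj₁ (proj₂ UO))
      p1 : r₁ ∘ (l₁ ∘ u) ≡ r₁ ∘ a
      p1 = trans (sym (assoc r₁ l₁ u)) (trans (cong (_∘ u) (sym eo)) eO)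
      p2 : r₂ ∘ (l₁ ∘ u) ≡ r₂ ∘ a
      p2 = begin
        r₂ ∘ (l₁ ∘ u) ≡⟨ sym (assoc r₂ l₁ u) ⟩
        (r₂ ∘ l₁) ∘ u ≡⟨ cong (_∘ u) c ⟩
        (k ∘ l₂) ∘ u  ≡⟨ assoc k l₂ u ⟩
        k ∘ (l₂ ∘ u)  ≡⟨ cong (k ∘_) eb ⟩
        k ∘ b         ≡⟨ sym e ⟩
        r₂ ∘ a ∎
      l₁u≡a : l₁ ∘ u ≡ a
      l₁u≡a = unique-eq (IsPullback.universal R (r₁ ∘ a) (r₂ ∘ a) eR) (p1 , p2) (refl , refl)
      uniq : ∀ u' → (l₁ ∘ u' ≡ a) × (l₂ ∘ u' ≡ b) → u ≡ u'
      uniq u' (e1 , e2) = proj₂ (proj₂ UO) u'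
        (trans (cong (_∘ u') eo) (trans (assoc r₁ l₁ u') (cong (r₁ ∘_) e1)) , e2)

-- Displayed categories: a category T with a functor p : T → C, presented
-- fibrewise (Ty Γ = objects of T over Γ, Over σ B A = maps B → A over σ).

record Displayed {o h} (C : Category o h) (o' h' : Level) : Set (o ⊔ h ⊔ lsuc (o' ⊔ h')) where
  open Category C
  infixr 9 _∘ᴰ_
  field
    Ty    : Obj → Set o'
    Over  : ∀ {Δ Γ} → Hom Δ Γ → Ty Δ → Ty Γ → Set h'
    idᴰ   : ∀ {Γ} {A : Ty Γ} → Over id A A
    _∘ᴰ_  : ∀ {Θ Δ Γ} {σ : Hom Δ Γ} {τ : Hom Θ Δ} {A : Ty Γ} {B : Ty Δ} {E : Ty Θ} →
            Over σ B A → Over τ E B → Over (σ ∘ τ) E A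
    idˡᴰ  : ∀ {Δ Γ} {σ : Hom Δ Γ} {B : Ty Δ} {A : Ty Γ} (f : Over σ B A) →
            subst (λ s → Over s B A) (idˡ σ) (idᴰ ∘ᴰ f) ≡ f
    idʳᴰ  : ∀ {Δ Γ} {σ : Hom Δ Γ} {B : Ty Δ} {A : Ty Γ} (f : Over σ B A) →
            subst (λ s → Over s B A) (idʳ σ) (f ∘ᴰ idᴰ) ≡ f
    assocᴰ : ∀ {Ξ Θ Δ Γ} {σ : Hom Δ Γ} {τ : Hom Θ Δ} {ρ : Hom Ξ Θ}
               {A : Ty Γ} {B : Ty Δ} {E : Ty Θ} {D : Ty Ξ}
             (f : Over σ B A) (g : Over τ E B) (k : Over ρ D E) →
             subst (λ s → Over s D A) (assoc σ τ ρ) ((f ∘ᴰ g) ∘ᴰ k) ≡ f ∘ᴰ (g ∘ᴰ k)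

  IsCartesian : ∀ {Δ Γ} {σ : Hom Δ Γ} {B : Ty Δ} {A : Ty Γ} → Over σ B A → Set (o ⊔ h ⊔ o' ⊔ h')
  IsCartesian {Δ} {Γ} {σ} {B} {A} f =
    ∀ {Θ} (τ : Hom Θ Δ) {E : Ty Θ} (g : Over (σ ∘ τ) E A) →
    UniqueΣ (λ (k : Over τ E B) → f ∘ᴰ k ≡ g)

-- Full comprehension categories (cloven fibration, fully faithful χ into C^→
-- with cod ∘ χ = p, sending cartesian arrows to pullback squares)

record FullCompCat (o h o' h' : Level) : Set (lsuc (o ⊔ h ⊔ o' ⊔ h')) where
  field
    C : Category o h
    T : Displayed C o' h'
  open Category C
  open Displayed T
  infixl 20 _[_]
  infixl 15 _⊙_
  field
    _[_]      : ∀ {Δ Γ} → Ty Γ → Hom Δ Γ → Ty Δ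
    lift      : ∀ {Δ Γ} (A : Ty Γ) (σ : Hom Δ Γ) → Over σ (A [ σ ]) A
    lift-cart : ∀ {Δ Γ} (A : Ty Γ) (σ : Hom Δ Γ) → IsCartesian (lift A σ)
    -- comprehension  χ(A) : Γ.A → Γ,  χ(f) = (χ₁ f , σ)
    _⊙_       : (Γ : Obj) → Ty Γ → Obj
    χ         : ∀ {Γ} (A : Ty Γ) → Hom (Γ ⊙ A) Γ
    χ₁        : ∀ {Δ Γ} {σ : Hom Δ Γ} {B : Ty Δ} {A : Ty Γ} → Over σ B A → Hom (Δ ⊙ B) (Γ ⊙ A)
    χ-sq      : ∀ {Δ Γ} {σ : Hom Δ Γ} {B : Ty Δ} {A : Ty Γ} (f : Over σ B A) →
                χ A ∘ χ₁ f ≡ σ ∘ χ B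
    χ-id      : ∀ {Γ} {A : Ty Γ} → χ₁ (idᴰ {A = A}) ≡ id
    χ-∘       : ∀ {Θ Δ Γ} {σ : Hom Δ Γ} {τ : Hom Θ Δ} {A : Ty Γ} {B : Ty Δ} {E : Ty Θ}
                (f : Over σ B A) (g : Over τ E B) → χ₁ (f ∘ᴰ g) ≡ χ₁ f ∘ χ₁ g
    χ-full    : ∀ {Δ Γ} (σ : Hom Δ Γ) {B : Ty Δ} {A : Ty Γ} (k : Hom (Δ ⊙ B) (Γ ⊙ A)) →
                χ A ∘ k ≡ σ ∘ χ B → Σ[ f ∈ Over σ B A ] χ₁ f ≡ k
    χ-faithful : ∀ {Δ Γ} {σ : Hom Δ Γ} {B : Ty Δ} {A : Ty Γ} (f g : Over σ B A) →
                χ₁ f ≡ χ₁ g → f ≡ g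
    χ-pb      : ∀ {Δ Γ} {σ : Hom Δ Γ} {B : Ty Δ} {A : Ty Γ} (f : Over σ B A) →
                IsCartesian f → IsPullback (χ₁ f) (χ B) (χ A) σ

record CompData {o h} (C : Category o h) (t : Level) : Set (o ⊔ h ⊔ lsuc t) where
  open Category C
  infixl 20 _[_]
  infixl 15 _⊙_
  field
    Ty   : Obj → Set t
    _[_] : ∀ {Δ Γ} → Ty Γ → Hom Δ Γ → Ty Δ
    _⊙_  : (Γ : Obj) → Ty Γ → Obj
    χ    : ∀ {Γ} (A : Ty Γ) → Hom (Γ ⊙ A) Γ
    _·_  : ∀ {Δ Γ} (σ : Hom Δ Γ) (A : Ty Γ) → Hom (Δ ⊙ A [ σ ]) (Γ ⊙ A)
    ·-pb : ∀ {Δ Γ} (σ : Hom Δ Γ) (A : Ty Γ) → IsPullback (σ · A) (χ (A [ σ ])) (χ A) σ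

  Section : ∀ {Γ} → Ty Γ → Set h
  Section {Γ} A = Σ[ s ∈ Hom Γ (Γ ⊙ A) ] (χ A ∘ s ≡ id)

  reindexU : ∀ {Δ Γ} {A : Ty Γ} (s : Section A) (σ : Hom Δ Γ) →
             UniqueΣ (λ (u : Hom Δ (Δ ⊙ A [ σ ])) → ((σ · A) ∘ u ≡ proj₁ s ∘ σ) × (χ (A [ σ ]) ∘ u ≡ id))
  reindexU {A = A} (s , e) σ = IsPullback.universal (·-pb σ _) (s ∘ σ) id
    (trans (sym (assoc (χ A) s σ)) (trans (cong (_∘ σ) e) (trans (idˡ σ) (sym (idʳ σ)))))

  _⟦_⟧ : ∀ {Δ Γ} {A : Ty Γ} → Section A → (σ : Hom Δ Γ) → Section (A [ σ ])
  s ⟦ σ ⟧ = proj₁ (reindexU s σ) , proj₂ (proj₁ (proj₂ (reindexU s σ)))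

  ⟦⟧-sq : ∀ {Δ Γ} {A : Ty Γ} (s : Section A) (σ : Hom Δ Γ) → (σ · A) ∘ proj₁ (s ⟦ σ ⟧) ≡ proj₁ s ∘ σ
  ⟦⟧-sq s σ = proj₁ (proj₁ (proj₂ (reindexU s σ)))

  record IsUnitType {Γ} (one : Ty Γ) (tt : Section one) : Set (h ⊔ t) where
    field
      urec   : (E : Ty (Γ ⊙ one)) → Section (E [ proj₁ tt ]) → Section E
      urec-β : (E : Ty (Γ ⊙ one)) (d : Section (E [ proj₁ tt ])) →
               proj₁ (urec E d) ∘ proj₁ tt ≡ (proj₁ tt · E) ∘ proj₁ d

  WeaklyStableUnit : Set (o ⊔ h ⊔ t)
  WeaklyStableUnit = (Γ : Obj) → Σ[ one ∈ Ty Γ ] Σ[ tt ∈ Section one ]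
                     (∀ {Δ} (σ : Hom Δ Γ) → IsUnitType (one [ σ ]) (tt ⟦ σ ⟧))

  liftTo : ∀ {Δ Γ} (σ : Hom Δ Γ) {A : Ty Γ} {A' : Ty Δ} → A [ σ ] ≡ A' → Hom (Δ ⊙ A') (Γ ⊙ A)
  liftTo σ {A} e = subst (λ X → Hom (_ ⊙ X) (_ ⊙ A)) e (σ · A)

  tt-square : ∀ {Δ Γ} (σ : Hom Δ Γ) {A : Ty Γ} {A' : Ty Δ} (e : A [ σ ] ≡ A')
              (t : Section A) (t' : Section A') → subst Section e (t ⟦ σ ⟧) ≡ t' →
              liftTo σ e ∘ proj₁ t' ≡ proj₁ t ∘ σ
  tt-square σ refl t .(t ⟦ σ ⟧) refl = ⟦⟧-sq t σ

  -- strictly stable unit types, for a split structure (only the type part of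
  -- the strict functoriality of reindexing is needed to state it)
  module _ (split : ∀ {Θ Δ Γ} (A : Ty Γ) (σ : Hom Δ Γ) (τ : Hom Θ Δ) → A [ σ ∘ τ ] ≡ A [ σ ] [ τ ]) where

    tyEq : ∀ {Y Γ Δ' Δ} (E : Ty Y) (f : Hom Γ Y) (g : Hom Δ Γ) (f' : Hom Δ' Y) (g' : Hom Δ Δ') →
           f' ∘ g' ≡ f ∘ g → E [ f ] [ g ] ≡ E [ f' ] [ g' ]
    tyEq E f g f' g' sq = trans (sym (split E f g)) (trans (cong (E [_]) (sym sq)) (split E f' g'))

    record StrictlyStableUnit : Set (o ⊔ h ⊔ t) where
      field
        one        : (Γ : Obj) → Ty Γ
        tt         : (Γ : Obj) → Section (one Γ)
        urec       : (Γ : Obj) (E : Ty (Γ ⊙ one Γ)) → Section (E [ proj₁ (tt Γ) ]) → Section E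
        urec-β     : (Γ : Obj) (E : Ty (Γ ⊙ one Γ)) (d : Section (E [ proj₁ (tt Γ) ])) →
                     proj₁ (urec Γ E d) ∘ proj₁ (tt Γ) ≡ (proj₁ (tt Γ) · E) ∘ proj₁ d
        one-stable : ∀ {Δ Γ} (σ : Hom Δ Γ) → one Γ [ σ ] ≡ one Δ
        tt-stable  : ∀ {Δ Γ} (σ : Hom Δ Γ) → subst Section (one-stable σ) (tt Γ ⟦ σ ⟧) ≡ tt Δ
        urec-stable : ∀ {Δ Γ} (σ : Hom Δ Γ) (E : Ty (Γ ⊙ one Γ)) (d : Section (E [ proj₁ (tt Γ) ])) →
                     urec Γ E d ⟦ liftTo σ (one-stable σ) ⟧
                     ≡ urec Δ (E [ liftTo σ (one-stable σ) ])
                         (subst Section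
                            (tyEq E (proj₁ (tt Γ)) σ (liftTo σ (one-stable σ)) (proj₁ (tt Δ))
                               (tt-square σ (one-stable σ) (tt Γ) (tt Δ) (tt-stable σ)))
                            (d ⟦ σ ⟧))

module _ {o h o' h'} (𝒞 : FullCompCat o h o' h') where
  open FullCompCat 𝒞
  open Category C
  open Displayed T

  toData : CompData C o'
  toData = record
    { Ty = Ty ; _[_] = _[_] ; _⊙_ = _⊙_ ; χ = χ
    ; _·_ = λ σ A → χ₁ (lift A σ)
    ; ·-pb = λ σ A → χ-pb (lift A σ) (lift-cart A σ) }

  data IsDisplay : ∀ {Y X} → Hom Y X → Set (o ⊔ h ⊔ o') where
    disp-χ : ∀ {Γ} (A : Ty Γ) → IsDisplay (χ A)
    disp-∘ : ∀ {X Y Z} {f : Hom Y X} {g : Hom Z Y} → IsDisplay f → IsDisplay g → IsDisplay (f ∘ g)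

  IsProjection : ∀ {Z Y} → Hom Z Y → Set (o ⊔ h)
  IsProjection {Z} g = Σ[ K ∈ Obj ] Σ[ q ∈ Hom Z K ] IsProduct g q

  -- dependent exponential Π[f,g] in C/X :  C/X(W, Π[f,g]) ≅ C/Y(W ×_X Y, Z) naturally in W → X
  -- (for every pullback W' of w : W → X along f, with projections p : W' → W, q : W' → Y)
  record DepExp {X Y Z} (f : Hom Y X) (g : Hom Z Y) : Set (o ⊔ h) where
    field
      Π   : Obj
      πΠ  : Hom Π X
      iso : ∀ {W W'} (w : Hom W X) (p : Hom W' W) (q : Hom W' Y) → IsPullback p q w f →
            (Σ[ k ∈ Hom W Π ] πΠ ∘ k ≡ w) ↔ (Σ[ l ∈ Hom W' Z ] g ∘ l ≡ q)
      natural : ∀ {W₁ W₁' W₂ W₂'}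
                  (w₁ : Hom W₁ X) (p₁ : Hom W₁' W₁) (q₁ : Hom W₁' Y) (pb₁ : IsPullback p₁ q₁ w₁ f)
                  (w₂ : Hom W₂ X) (p₂ : Hom W₂' W₂) (q₂ : Hom W₂' Y) (pb₂ : IsPullback p₂ q₂ w₂ f)
                  (u : Hom W₂ W₁) (eu : w₁ ∘ u ≡ w₂)
                  (u' : Hom W₂' W₁') (e₁ : p₁ ∘ u' ≡ u ∘ p₂) (e₂ : q₁ ∘ u' ≡ q₂)
                  (k : Σ[ k ∈ Hom W₁ Π ] πΠ ∘ k ≡ w₁) →
                proj₁ (Inverse.to (iso w₂ p₂ q₂ pb₂)
                        (proj₁ k ∘ u , trans (sym (assoc πΠ (proj₁ k) u)) (trans (cong (_∘ u) (proj₂ k)) eu)))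
                ≡ proj₁ (Inverse.to (iso w₁ p₁ q₁ pb₁) k) ∘ u'

  record LF : Set (o ⊔ h ⊔ o') where
    field
      products : FiniteProducts
      depExp   : ∀ {X Y Z} (f : Hom Y X) (g : Hom Z Y) → IsDisplay f →
                 IsDisplay g ⊎ IsProjection g → DepExp f g

  record Ty! (Γ : Obj) : Set (o ⊔ h ⊔ o') where
    constructor tri
    field
      V : Obj
      E : Ty V
      n : Hom Γ V

  ⌊_⌋ : ∀ {Γ} → Ty! Γ → Ty Γ
  ⌊ tri V E n ⌋ = E [ n ]

  _[_]! : ∀ {Δ Γ} → Ty! Γ → Hom Δ Γ → Ty! Δ
  tri V E n [ σ ]! = tri V E (n ∘ σ)

  canon : ∀ {Δ Γ} (A : Ty! Γ) (σ : Hom Δ Γ) → Over σ ⌊ A [ σ ]! ⌋ ⌊ A ⌋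
  canon (tri V E n) σ = proj₁ (lift-cart E n σ (lift E (n ∘ σ)))

  canon-pb : ∀ {Δ Γ} (σ : Hom Δ Γ) (A : Ty! Γ) →
             IsPullback (χ₁ (canon A σ)) (χ ⌊ A [ σ ]! ⌋) (χ ⌊ A ⌋) σ
  canon-pb σ (tri V E n) =
    paste (χ-pb (lift E n) (lift-cart E n)) (χ-sq c)
          (trans (cong χ₁ (sym ceq)) (χ-∘ (lift E n) c))
          (χ-pb (lift E (n ∘ σ)) (lift-cart E (n ∘ σ)))
    where
    c = canon (tri V E n) σ
    ceq : lift E n ∘ᴰ c ≡ lift E (n ∘ σ)
    ceq = proj₁ (proj₂ (lift-cart E n σ (lift E (n ∘ σ))))

  Bang : CompData C (o ⊔ h ⊔ o')
  Bang = record
    { Ty = Ty! ; _[_] = _[_]! ; _⊙_ = λ Γ A → Γ ⊙ ⌊ A ⌋ ; χ = λ A → χ ⌊ A ⌋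
    ; _·_ = λ σ A → χ₁ (canon A σ) ; ·-pb = canon-pb }

  Bang-split : ∀ {Θ Δ Γ} (A : Ty! Γ) (σ : Hom Δ Γ) (τ : Hom Θ Δ) → A [ σ ∘ τ ]! ≡ (A [ σ ]!) [ τ ]!
  Bang-split (tri V E n) σ τ = cong (tri V E) (sym (assoc n σ τ))

-- Let (U, u) be the unit type over the terminal object and put 1_Γ := (⊤, U, !_Γ) in C_!.  Reindexing in
-- C_! is precomposition and maps into ⊤ are unique, so 1_Γ and tt_Γ := u[!_Γ] are strictly stable.
-- Eliminating into E = (V, F, n) over Γ.1 amounts to filling a square from tt_Γ to χ F with bottom
-- n : Γ.1 → V.  By (LF) the exponential M = V^{⊤.U} classifies such maps n, so X := M.F[ev ∘ tt]
-- classifies whole squares.  Fill the generic square over X once, with the weak unit type over X, and pull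
-- the filler back along (classifying map).1: classifying maps compose, hence the eliminators commute
-- strictly with reindexing.
module Submission where

open import Defs
open import Axiom.UniquenessOfIdentityProofs.WithK using (uip)
open import Data.Product using (Σ; Σ-syntax; _×_; _,_; proj₁; proj₂)
open import Data.Sum using (inj₂)
open import Data.Unit using () renaming (tt to ⋆)
open import Function.Bundles using (_↔_; Inverse)
open import Relation.Binary.PropositionalEquality
  using (_≡_; refl; sym; trans; cong; subst; module ≡-Reasoning)

open ≡-Reasoning

proj₁-injective : ∀ {a b} {A : Set a} {X : Set b} {f g : A → X} {s s' : Σ A (λ x → f x ≡ g x)} →
                  proj₁ s ≡ proj₁ s' → s ≡ s'
proj₁-injective {s = x , p} {.x , q} refl = cong (x ,_) (uip p q)

module CategoryFacts {o h} (C : Category o h) where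
  open Category C

  pullˡ : ∀ {W X Y Z} {f : Hom Y Z} {g : Hom X Y} {r : Hom X Z} (k : Hom W X) →
          f ∘ g ≡ r → f ∘ (g ∘ k) ≡ r ∘ k
  pullˡ {f = f} {g} k e = trans (sym (assoc f g k)) (cong (_∘ k) e)

  IsPullback-jointly-monic : ∀ {P X Y Z} {p₁ : Hom P X} {p₂ : Hom P Y} {f : Hom X Z} {g : Hom Y Z} →
    IsPullback p₁ p₂ f g → ∀ {W} {a b : Hom W P} → p₁ ∘ a ≡ p₁ ∘ b → p₂ ∘ a ≡ p₂ ∘ b → a ≡ b
  IsPullback-jointly-monic {p₁ = p₁} {p₂} {g = g} pb {a = a} e₁ e₂ =
    unique-eq (IsPullback.universal pb (p₁ ∘ a) (p₂ ∘ a)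
                 (trans (pullˡ a (IsPullback.commute pb)) (assoc g p₂ a)))
              (refl , refl) (sym e₁ , sym e₂)

  IsPullback-swap : ∀ {P X Y Z} {p₁ : Hom P X} {p₂ : Hom P Y} {f : Hom X Z} {g : Hom Y Z} →
                    IsPullback p₁ p₂ f g → IsPullback p₂ p₁ g f
  IsPullback-swap pb = record
    { commute   = sym (IsPullback.commute pb)
    ; universal = λ a b e →
        let (u , (e₁ , e₂) , unique) = IsPullback.universal pb b a (sym e)
        in u , (e₂ , e₁) , λ u' (e₂' , e₁') → unique u' (e₁' , e₂') }

  record Square {A B X Y} (i : Hom A B) (p : Hom X Y) : Set h where
    field
      top      : Hom A X
      bottom   : Hom B Y
      commutes : p ∘ top ≡ bottom ∘ i

  Filler : ∀ {A B X Y} {i : Hom A B} {p : Hom X Y} → Square i p → Set h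
  Filler {B = B} {X} {i = i} {p} sq = Σ[ ℓ ∈ Hom B X ] (p ∘ ℓ ≡ Square.bottom sq) × (ℓ ∘ i ≡ Square.top sq)

module CompDataFacts {o h t} {C : Category o h} (D : CompData C t) where
  open Category C
  open CompData D
  open CategoryFacts C

  χ-·-section : ∀ {Δ Γ} (σ : Hom Δ Γ) (A : Ty Γ) (s : Section (A [ σ ])) → χ A ∘ ((σ · A) ∘ proj₁ s) ≡ σ
  χ-·-section σ A (s , e) = begin
    χ A ∘ ((σ · A) ∘ s)   ≡⟨ pullˡ s (IsPullback.commute (·-pb σ A)) ⟩
    (σ ∘ χ (A [ σ ])) ∘ s ≡⟨ assoc σ _ s ⟩
    σ ∘ (χ (A [ σ ]) ∘ s) ≡⟨ cong (σ ∘_) e ⟩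
    σ ∘ id                ≡⟨ idʳ σ ⟩
    σ                     ∎

  Section-≡ : ∀ {Δ Γ} (σ : Hom Δ Γ) (A : Ty Γ) {s s' : Section (A [ σ ])} →
              (σ · A) ∘ proj₁ s ≡ (σ · A) ∘ proj₁ s' → s ≡ s'
  Section-≡ σ A {s} {s'} e =
    proj₁-injective (IsPullback-jointly-monic (·-pb σ A) e (trans (proj₂ s) (sym (proj₂ s'))))

  sectionOf : ∀ {Δ Γ} (σ : Hom Δ Γ) (A : Ty Γ) (ℓ : Hom Δ (Γ ⊙ A)) → χ A ∘ ℓ ≡ σ →
              Σ[ s ∈ Section (A [ σ ]) ] (σ · A) ∘ proj₁ s ≡ ℓ
  sectionOf σ A ℓ e =
    let (s , (s-ℓ , s-id) , _) = IsPullback.universal (·-pb σ A) ℓ id (trans e (sym (idʳ σ)))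
    in (s , s-id) , s-ℓ

  liftTo-χ : ∀ {Δ Γ} (σ : Hom Δ Γ) {A : Ty Γ} {A' : Ty Δ} (e : A [ σ ] ≡ A') →
             χ A ∘ liftTo σ e ≡ σ ∘ χ A'
  liftTo-χ σ {A} refl = IsPullback.commute (·-pb σ A)

  -- The eliminator only targets families over Γ.1; F[n] is one, and ·-pb transports its section back to V.F.
  unitType-filler : ∀ {Γ} {one : Ty Γ} {tt : Section one} → IsUnitType one tt →
                    ∀ {V} (F : Ty V) (sq : Square (proj₁ tt) (χ F)) → Filler sq
  unitType-filler {Γ} {one} {tt , _} unit F sq = (n · F) ∘ proj₁ r , χ-·-section n F r , fills-top
    where
    open Square sq renaming (top to δ; bottom to n)
    y-universal : UniqueΣ (λ (y : Hom Γ ((Γ ⊙ one) ⊙ F [ n ])) → ((n · F) ∘ y ≡ δ) × (χ (F [ n ]) ∘ y ≡ tt))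
    y-universal = IsPullback.universal (·-pb n F) δ tt commutes
    y : Hom Γ ((Γ ⊙ one) ⊙ F [ n ])
    y = proj₁ y-universal
    d : Σ[ d ∈ Section (F [ n ] [ tt ]) ] (tt · (F [ n ])) ∘ proj₁ d ≡ y
    d = sectionOf tt (F [ n ]) y (proj₂ (proj₁ (proj₂ y-universal)))
    r : Section (F [ n ])
    r = IsUnitType.urec unit (F [ n ]) (proj₁ d)
    fills-top : ((n · F) ∘ proj₁ r) ∘ tt ≡ δ
    fills-top = begin
      ((n · F) ∘ proj₁ r) ∘ tt                       ≡⟨ assoc _ _ _ ⟩
      (n · F) ∘ (proj₁ r ∘ tt)                       ≡⟨ cong ((n · F) ∘_) (IsUnitType.urec-β unit (F [ n ]) (proj₁ d)) ⟩
      (n · F) ∘ ((tt · (F [ n ])) ∘ proj₁ (proj₁ d)) ≡⟨ cong ((n · F) ∘_) (proj₂ d) ⟩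
      (n · F) ∘ y                                    ≡⟨ proj₁ (proj₁ (proj₂ y-universal)) ⟩
      δ                                              ∎

module BangFacts {o h o' h'} (𝒞 : FullCompCat o h o' h') where
  open FullCompCat 𝒞 using (C; lift; lift-cart; χ₁; χ-∘)
  open Category C
  module D = CompData (toData 𝒞)
  module B = CompData (Bang 𝒞)

  canon-· : ∀ {V Δ Γ} (F : D.Ty V) (n : Hom Γ V) (σ : Hom Δ Γ) →
            (n D.· F) ∘ (σ B.· tri V F n) ≡ (n ∘ σ) D.· F
  canon-· F n σ = trans (sym (χ-∘ _ _)) (cong χ₁ (proj₁ (proj₂ (lift-cart F n σ (lift F (n ∘ σ))))))

  liftTo-· : ∀ {V Δ Γ} (F : D.Ty V) (n : Hom Γ V) (m : Hom Δ V) (σ : Hom Δ Γ)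
             (e : tri V F (n ∘ σ) ≡ tri V F m) → (n D.· F) ∘ B.liftTo σ e ≡ m D.· F
  liftTo-· F n .(n ∘ σ) σ refl = canon-· F n σ

  reindex-· : ∀ {V Δ Γ} (F : D.Ty V) (n : Hom Γ V) (s : B.Section (tri V F n)) (σ : Hom Δ Γ) →
              ((n ∘ σ) D.· F) ∘ proj₁ (s B.⟦ σ ⟧) ≡ ((n D.· F) ∘ proj₁ s) ∘ σ
  reindex-· {V} F n s σ = begin
    ((n ∘ σ) D.· F) ∘ proj₁ (s B.⟦ σ ⟧)                     ≡⟨ cong (_∘ proj₁ (s B.⟦ σ ⟧)) (sym (canon-· F n σ)) ⟩
    ((n D.· F) ∘ (σ B.· tri V F n)) ∘ proj₁ (s B.⟦ σ ⟧)     ≡⟨ assoc _ _ _ ⟩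
    (n D.· F) ∘ ((σ B.· tri V F n) ∘ proj₁ (s B.⟦ σ ⟧))     ≡⟨ cong ((n D.· F) ∘_) (B.⟦⟧-sq s σ) ⟩
    (n D.· F) ∘ (proj₁ s ∘ σ)                               ≡⟨ sym (assoc _ _ _) ⟩
    ((n D.· F) ∘ proj₁ s) ∘ σ                               ∎

  subst-· : ∀ {V Γ} (F : D.Ty V) (a b : Hom Γ V) (e : tri V F a ≡ tri V F b) (s : B.Section (tri V F a)) →
            (b D.· F) ∘ proj₁ (subst B.Section e s) ≡ (a D.· F) ∘ proj₁ s
  subst-· F a .a refl s = refl

module StrictUnit {o h o' h'} (𝒞 : FullCompCat o h o' h') (lf : LF 𝒞)
                  (weak : CompData.WeaklyStableUnit (toData 𝒞)) where
  open FullCompCat 𝒞 using (C)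
  open Category C
  open LF lf using (products; depExp)
  open FiniteProducts products
  open CategoryFacts C
  open BangFacts 𝒞
  open CompDataFacts (toData 𝒞)
  module BangSections = CompDataFacts (Bang 𝒞)

  ! : ∀ Γ → Hom Γ terminal
  ! Γ = proj₁ (terminal-is Γ)

  !-unique : ∀ {Γ} (f g : Hom Γ terminal) → f ≡ g
  !-unique f g = unique-eq (terminal-is _) ⋆ ⋆

  U : D.Ty terminal
  U = proj₁ (weak terminal)

  u : D.Section U
  u = proj₁ (proj₂ (weak terminal))

  𝟙 : ∀ Γ → Ty! 𝒞 Γ
  𝟙 Γ = tri terminal U (! Γ)

  _⊙𝟙 : Obj → Obj
  Γ ⊙𝟙 = Γ B.⊙ 𝟙 Γ

  tt! : ∀ Γ → B.Section (𝟙 Γ)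
  tt! Γ = u D.⟦ ! Γ ⟧

  tt : ∀ Γ → Hom Γ (Γ ⊙𝟙)
  tt Γ = proj₁ (tt! Γ)

  q : ∀ Γ → Hom (Γ ⊙𝟙) (terminal D.⊙ U)
  q Γ = ! Γ D.· U

  𝟙-stable : ∀ {Δ Γ} (σ : Hom Δ Γ) → 𝟙 Γ B.[ σ ] ≡ 𝟙 Δ
  𝟙-stable σ = cong (tri terminal U) (!-unique _ _)

  tt-stable : ∀ {Δ Γ} (σ : Hom Δ Γ) → subst B.Section (𝟙-stable σ) (tt! Γ B.⟦ σ ⟧) ≡ tt! Δ
  tt-stable {Δ} {Γ} σ = Section-≡ (! Δ) U (begin
    q Δ ∘ proj₁ (subst B.Section (𝟙-stable σ) (tt! Γ B.⟦ σ ⟧))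
      ≡⟨ subst-· U (! Γ ∘ σ) (! Δ) (𝟙-stable σ) (tt! Γ B.⟦ σ ⟧) ⟩
    ((! Γ ∘ σ) D.· U) ∘ proj₁ (tt! Γ B.⟦ σ ⟧)  ≡⟨ reindex-· U (! Γ) (tt! Γ) σ ⟩
    (q Γ ∘ tt Γ) ∘ σ                           ≡⟨ cong (_∘ σ) (D.⟦⟧-sq u (! Γ)) ⟩
    (proj₁ u ∘ ! Γ) ∘ σ                        ≡⟨ assoc _ _ _ ⟩
    proj₁ u ∘ (! Γ ∘ σ)                        ≡⟨ cong (proj₁ u ∘_) (!-unique _ _) ⟩
    proj₁ u ∘ ! Δ                              ≡⟨ sym (D.⟦⟧-sq u (! Δ)) ⟩
    q Δ ∘ tt Δ                                 ∎)

  infixl 25 _·𝟙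
  _·𝟙 : ∀ {Δ Γ} → Hom Δ Γ → Hom (Δ ⊙𝟙) (Γ ⊙𝟙)
  σ ·𝟙 = B.liftTo σ (𝟙-stable σ)

  q-·𝟙 : ∀ {Δ Γ} (σ : Hom Δ Γ) → q Γ ∘ σ ·𝟙 ≡ q Δ
  q-·𝟙 {Δ} {Γ} σ = liftTo-· U (! Γ) (! Δ) σ (𝟙-stable σ)

  χ-·𝟙 : ∀ {Δ Γ} (σ : Hom Δ Γ) → B.χ (𝟙 Γ) ∘ σ ·𝟙 ≡ σ ∘ B.χ (𝟙 Δ)
  χ-·𝟙 σ = BangSections.liftTo-χ σ (𝟙-stable σ)

  ·𝟙-tt : ∀ {Δ Γ} (σ : Hom Δ Γ) → σ ·𝟙 ∘ tt Δ ≡ tt Γ ∘ σ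
  ·𝟙-tt {Δ} {Γ} σ = B.tt-square σ (𝟙-stable σ) (tt! Γ) (tt! Δ) (tt-stable σ)

  ·𝟙-∘ : ∀ {Θ Δ Γ} (σ : Hom Δ Γ) (τ : Hom Θ Δ) → (σ ∘ τ) ·𝟙 ≡ σ ·𝟙 ∘ τ ·𝟙
  ·𝟙-∘ {Θ} {Δ} {Γ} σ τ = IsPullback-jointly-monic (D.·-pb (! Γ) U)
    (begin
      q Γ ∘ (σ ∘ τ) ·𝟙      ≡⟨ q-·𝟙 (σ ∘ τ) ⟩
      q Θ                   ≡⟨ sym (q-·𝟙 τ) ⟩
      q Δ ∘ τ ·𝟙            ≡⟨ sym (pullˡ (τ ·𝟙) (q-·𝟙 σ)) ⟩
      q Γ ∘ (σ ·𝟙 ∘ τ ·𝟙)   ∎)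
    (begin
      B.χ (𝟙 Γ) ∘ (σ ∘ τ) ·𝟙          ≡⟨ χ-·𝟙 (σ ∘ τ) ⟩
      (σ ∘ τ) ∘ B.χ (𝟙 Θ)             ≡⟨ assoc σ τ _ ⟩
      σ ∘ (τ ∘ B.χ (𝟙 Θ))             ≡⟨ cong (σ ∘_) (sym (χ-·𝟙 τ)) ⟩
      σ ∘ (B.χ (𝟙 Δ) ∘ τ ·𝟙)          ≡⟨ sym (assoc σ _ _) ⟩
      (σ ∘ B.χ (𝟙 Δ)) ∘ τ ·𝟙          ≡⟨ sym (pullˡ (τ ·𝟙) (χ-·𝟙 σ)) ⟩
      B.χ (𝟙 Γ) ∘ (σ ·𝟙 ∘ τ ·𝟙)       ∎)

  module Exponential (V : Obj) where
    private
      P×V : Obj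
      P×V = (terminal D.⊙ U) ×ₒ V

      exp : DepExp 𝒞 (D.χ U) (π₁ {terminal D.⊙ U} {V})
      exp = depExp (D.χ U) π₁ (disp-χ U) (inj₂ (V , π₂ , product-is))

      module E = DepExp exp

    M : Obj
    M = E.Π

    private
      -- Γ ⊙𝟙 is the pullback of χ U along ! Γ, so the (LF) adjunction identifies Γ → M with Γ ⊙𝟙 → V.
      transpose : ∀ Γ → (Σ[ k ∈ Hom Γ M ] E.πΠ ∘ k ≡ ! Γ) ↔ (Σ[ l ∈ Hom (Γ ⊙𝟙) P×V ] π₁ ∘ l ≡ q Γ)
      transpose Γ = E.iso (! Γ) (B.χ (𝟙 Γ)) (q Γ) (IsPullback-swap (D.·-pb (! Γ) U))

      over! : ∀ {Γ} (k : Hom Γ M) → Σ[ m ∈ Hom Γ M ] E.πΠ ∘ m ≡ ! Γ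
      over! k = k , !-unique _ _

      pair : ∀ {Γ} (n : Hom (Γ ⊙𝟙) V) → Σ[ l ∈ Hom (Γ ⊙𝟙) P×V ] π₁ ∘ l ≡ q Γ
      pair {Γ} n = proj₁ (product-is (q Γ) n) , proj₁ (proj₁ (proj₂ (product-is (q Γ) n)))

      π₂-pair : ∀ {Γ} (n : Hom (Γ ⊙𝟙) V) → π₂ ∘ proj₁ (pair n) ≡ n
      π₂-pair {Γ} n = proj₂ (proj₁ (proj₂ (product-is (q Γ) n)))

      pair-η : ∀ {Γ} (l : Σ[ l ∈ Hom (Γ ⊙𝟙) P×V ] π₁ ∘ l ≡ q Γ) → pair (π₂ ∘ proj₁ l) ≡ l
      pair-η {Γ} (l , e) = proj₁-injective (unique-eq (product-is (q Γ) (π₂ ∘ l))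
        (proj₁ (proj₂ (product-is (q Γ) (π₂ ∘ l)))) (e , refl))

    ev : ∀ {Γ} → Hom Γ M → Hom (Γ ⊙𝟙) V
    ev k = π₂ ∘ proj₁ (Inverse.to (transpose _) (over! k))

    curry : ∀ {Γ} → Hom (Γ ⊙𝟙) V → Hom Γ M
    curry n = proj₁ (Inverse.from (transpose _) (pair n))

    ev-curry : ∀ {Γ} (n : Hom (Γ ⊙𝟙) V) → ev (curry n) ≡ n
    ev-curry {Γ} n = begin
      π₂ ∘ proj₁ (Inverse.to (transpose Γ) (over! (curry n)))
        ≡⟨ cong (λ k → π₂ ∘ proj₁ (Inverse.to (transpose Γ) k)) (proj₁-injective refl) ⟩
      π₂ ∘ proj₁ (Inverse.to (transpose Γ) (Inverse.from (transpose Γ) (pair n)))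
        ≡⟨ cong (λ l → π₂ ∘ proj₁ l) (Inverse.strictlyInverseˡ (transpose Γ) (pair n)) ⟩
      π₂ ∘ proj₁ (pair n)
        ≡⟨ π₂-pair n ⟩
      n ∎

    curry-ev : ∀ {Γ} (k : Hom Γ M) → curry (ev k) ≡ k
    curry-ev {Γ} k = cong proj₁ (begin
      Inverse.from (transpose Γ) (pair (ev k))
        ≡⟨ cong (Inverse.from (transpose Γ)) (pair-η (Inverse.to (transpose Γ) (over! k))) ⟩
      Inverse.from (transpose Γ) (Inverse.to (transpose Γ) (over! k))
        ≡⟨ Inverse.strictlyInverseʳ (transpose Γ) (over! k) ⟩
      over! k ∎)

    ev-∘ : ∀ {Δ Γ} (k : Hom Γ M) (σ : Hom Δ Γ) → ev (k ∘ σ) ≡ ev k ∘ σ ·𝟙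
    ev-∘ {Δ} {Γ} k σ = begin
      π₂ ∘ proj₁ (Inverse.to (transpose Δ) (over! (k ∘ σ)))
        ≡⟨ cong (λ l → π₂ ∘ proj₁ (Inverse.to (transpose Δ) l)) (proj₁-injective refl) ⟩
      π₂ ∘ proj₁ (Inverse.to (transpose Δ) (k ∘ σ , _))
        ≡⟨ cong (π₂ ∘_) (E.natural (! Γ) (B.χ (𝟙 Γ)) (q Γ) (IsPullback-swap (D.·-pb (! Γ) U))
                                  (! Δ) (B.χ (𝟙 Δ)) (q Δ) (IsPullback-swap (D.·-pb (! Δ) U))
                                  σ (!-unique _ _) (σ ·𝟙) (χ-·𝟙 σ) (q-·𝟙 σ) (over! k)) ⟩
      π₂ ∘ (proj₁ (Inverse.to (transpose Γ) (over! k)) ∘ σ ·𝟙)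
        ≡⟨ sym (assoc _ _ _) ⟩
      ev k ∘ σ ·𝟙 ∎

    curry-∘ : ∀ {Δ Γ} (n : Hom (Γ ⊙𝟙) V) (σ : Hom Δ Γ) → curry (n ∘ σ ·𝟙) ≡ curry n ∘ σ
    curry-∘ n σ = begin
      curry (n ∘ σ ·𝟙)               ≡⟨ cong (λ m → curry (m ∘ σ ·𝟙)) (sym (ev-curry n)) ⟩
      curry (ev (curry n) ∘ σ ·𝟙)    ≡⟨ cong curry (sym (ev-∘ (curry n) σ)) ⟩
      curry (ev (curry n ∘ σ))       ≡⟨ curry-ev (curry n ∘ σ) ⟩
      curry n ∘ σ                    ∎

    ev-tt : Hom M V
    ev-tt = ev id ∘ tt M

    ev-tt-∘ : ∀ {Γ} (k : Hom Γ M) → ev-tt ∘ k ≡ ev k ∘ tt Γ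
    ev-tt-∘ {Γ} k = begin
      (ev id ∘ tt M) ∘ k       ≡⟨ assoc _ _ _ ⟩
      ev id ∘ (tt M ∘ k)       ≡⟨ cong (ev id ∘_) (sym (·𝟙-tt k)) ⟩
      ev id ∘ (k ·𝟙 ∘ tt Γ)    ≡⟨ sym (assoc _ _ _) ⟩
      (ev id ∘ k ·𝟙) ∘ tt Γ    ≡⟨ cong (_∘ tt Γ) (sym (ev-∘ id k)) ⟩
      ev (id ∘ k) ∘ tt Γ       ≡⟨ cong (λ k' → ev k' ∘ tt Γ) (idˡ k) ⟩
      ev k ∘ tt Γ              ∎

  module Generic {V} (F : D.Ty V) where
    open Exponential V

    X : Obj
    X = M D.⊙ F D.[ ev-tt ]

    generic : Square (tt X) (D.χ F)
    generic = record
      { top      = ev-tt D.· F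
      ; bottom   = ev (D.χ (F D.[ ev-tt ]))
      ; commutes = trans (IsPullback.commute (D.·-pb ev-tt F)) (ev-tt-∘ _) }

    generic-filler : Filler generic
    generic-filler = unitType-filler (proj₂ (proj₂ (weak terminal)) (! X)) F generic

    private
      classify-universal : ∀ {Γ} (sq : Square (tt Γ) (D.χ F)) →
        UniqueΣ (λ (c : Hom Γ X) → ((ev-tt D.· F) ∘ c ≡ Square.top sq) ×
                                   (D.χ (F D.[ ev-tt ]) ∘ c ≡ curry (Square.bottom sq)))
      classify-universal {Γ} sq = IsPullback.universal (D.·-pb ev-tt F) top (curry bottom) (begin
        D.χ F ∘ top              ≡⟨ commutes ⟩
        bottom ∘ tt Γ            ≡⟨ cong (_∘ tt Γ) (sym (ev-curry bottom)) ⟩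
        ev (curry bottom) ∘ tt Γ ≡⟨ sym (ev-tt-∘ (curry bottom)) ⟩
        ev-tt ∘ curry bottom     ∎)
        where open Square sq

    classify : ∀ {Γ} → Square (tt Γ) (D.χ F) → Hom Γ X
    classify sq = proj₁ (classify-universal sq)

    classify-top : ∀ {Γ} (sq : Square (tt Γ) (D.χ F)) → (ev-tt D.· F) ∘ classify sq ≡ Square.top sq
    classify-top sq = proj₁ (proj₁ (proj₂ (classify-universal sq)))

    classify-bottom : ∀ {Γ} (sq : Square (tt Γ) (D.χ F)) →
                      D.χ (F D.[ ev-tt ]) ∘ classify sq ≡ curry (Square.bottom sq)
    classify-bottom sq = proj₂ (proj₁ (proj₂ (classify-universal sq)))

    classify-∘ : ∀ {Δ Γ} (sq : Square (tt Γ) (D.χ F)) (sq' : Square (tt Δ) (D.χ F)) (σ : Hom Δ Γ) →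
                 Square.top sq' ≡ Square.top sq ∘ σ → Square.bottom sq' ≡ Square.bottom sq ∘ σ ·𝟙 →
                 classify sq' ≡ classify sq ∘ σ
    classify-∘ sq sq' σ top-≡ bottom-≡ = IsPullback-jointly-monic (D.·-pb ev-tt F)
      (begin
        (ev-tt D.· F) ∘ classify sq'        ≡⟨ classify-top sq' ⟩
        Square.top sq'                      ≡⟨ top-≡ ⟩
        Square.top sq ∘ σ                   ≡⟨ sym (pullˡ σ (classify-top sq)) ⟩
        (ev-tt D.· F) ∘ (classify sq ∘ σ)   ∎)
      (begin
        D.χ (F D.[ ev-tt ]) ∘ classify sq'        ≡⟨ classify-bottom sq' ⟩
        curry (Square.bottom sq')                 ≡⟨ cong curry bottom-≡ ⟩
        curry (Square.bottom sq ∘ σ ·𝟙)           ≡⟨ curry-∘ (Square.bottom sq) σ ⟩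
        curry (Square.bottom sq) ∘ σ              ≡⟨ sym (pullˡ σ (classify-bottom sq)) ⟩
        D.χ (F D.[ ev-tt ]) ∘ (classify sq ∘ σ)   ∎)

    -- Abstract: only the specification of the filler is used, and unfolding it swamps the type checker.
    abstract
      filler : ∀ {Γ} (sq : Square (tt Γ) (D.χ F)) → Filler sq
      filler {Γ} sq = ℓ ∘ c ·𝟙 , fills-bottom , fills-top
        where
        open Square sq
        ℓ : Hom (X ⊙𝟙) (V D.⊙ F)
        ℓ = proj₁ generic-filler
        c : Hom Γ X
        c = classify sq
        fills-bottom : D.χ F ∘ (ℓ ∘ c ·𝟙) ≡ bottom
        fills-bottom = begin
          D.χ F ∘ (ℓ ∘ c ·𝟙)                  ≡⟨ pullˡ (c ·𝟙) (proj₁ (proj₂ generic-filler)) ⟩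
          ev (D.χ (F D.[ ev-tt ])) ∘ c ·𝟙     ≡⟨ sym (ev-∘ _ c) ⟩
          ev (D.χ (F D.[ ev-tt ]) ∘ c)        ≡⟨ cong ev (classify-bottom sq) ⟩
          ev (curry bottom)                   ≡⟨ ev-curry bottom ⟩
          bottom                              ∎
        fills-top : (ℓ ∘ c ·𝟙) ∘ tt Γ ≡ top
        fills-top = begin
          (ℓ ∘ c ·𝟙) ∘ tt Γ   ≡⟨ assoc _ _ _ ⟩
          ℓ ∘ (c ·𝟙 ∘ tt Γ)   ≡⟨ cong (ℓ ∘_) (·𝟙-tt c) ⟩
          ℓ ∘ (tt X ∘ c)      ≡⟨ sym (assoc _ _ _) ⟩
          (ℓ ∘ tt X) ∘ c      ≡⟨ cong (_∘ c) (proj₂ (proj₂ generic-filler)) ⟩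
          (ev-tt D.· F) ∘ c   ≡⟨ classify-top sq ⟩
          top                 ∎

      filler-∘ : ∀ {Δ Γ} (sq : Square (tt Γ) (D.χ F)) (sq' : Square (tt Δ) (D.χ F)) (σ : Hom Δ Γ) →
                 Square.top sq' ≡ Square.top sq ∘ σ → Square.bottom sq' ≡ Square.bottom sq ∘ σ ·𝟙 →
                 proj₁ (filler sq') ≡ proj₁ (filler sq) ∘ σ ·𝟙
      filler-∘ sq sq' σ top-≡ bottom-≡ = begin
        ℓ ∘ classify sq' ·𝟙               ≡⟨ cong (λ c → ℓ ∘ c ·𝟙) (classify-∘ sq sq' σ top-≡ bottom-≡) ⟩
        ℓ ∘ (classify sq ∘ σ) ·𝟙          ≡⟨ cong (ℓ ∘_) (·𝟙-∘ (classify sq) σ) ⟩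
        ℓ ∘ (classify sq ·𝟙 ∘ σ ·𝟙)       ≡⟨ sym (assoc _ _ _) ⟩
        (ℓ ∘ classify sq ·𝟙) ∘ σ ·𝟙       ∎
        where
        ℓ : Hom (X ⊙𝟙) (V D.⊙ F)
        ℓ = proj₁ generic-filler

  open Generic using (filler; filler-∘)

  elim-square : ∀ Γ {V} (F : D.Ty V) (n : Hom (Γ ⊙𝟙) V) → B.Section (tri V F (n ∘ tt Γ)) →
                Square (tt Γ) (D.χ F)
  elim-square Γ F n d = record
    { top      = ((n ∘ tt Γ) D.· F) ∘ proj₁ d
    ; bottom   = n
    ; commutes = χ-·-section (n ∘ tt Γ) F d }

  elim : ∀ Γ {V} (F : D.Ty V) (n : Hom (Γ ⊙𝟙) V) (d : B.Section (tri V F (n ∘ tt Γ))) →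
         Σ[ s ∈ B.Section (tri V F n) ] (n D.· F) ∘ proj₁ s ≡ proj₁ (filler F (elim-square Γ F n d))
  elim Γ F n d = sectionOf n F (proj₁ ℓ) (proj₁ (proj₂ ℓ))
    where
    ℓ : Filler (elim-square Γ F n d)
    ℓ = filler F (elim-square Γ F n d)

  urec! : ∀ Γ (E : Ty! 𝒞 (Γ ⊙𝟙)) → B.Section (E B.[ tt Γ ]) → B.Section E
  urec! Γ (tri V F n) d = proj₁ (elim Γ F n d)

  urec!-β : ∀ Γ (E : Ty! 𝒞 (Γ ⊙𝟙)) (d : B.Section (E B.[ tt Γ ])) →
            proj₁ (urec! Γ E d) ∘ tt Γ ≡ (tt Γ B.· E) ∘ proj₁ d
  urec!-β Γ (tri V F n) d = IsPullback-jointly-monic (D.·-pb n F)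
    (begin
      (n D.· F) ∘ (proj₁ (urec! Γ E d) ∘ tt Γ)      ≡⟨ sym (assoc _ _ _) ⟩
      ((n D.· F) ∘ proj₁ (urec! Γ E d)) ∘ tt Γ      ≡⟨ cong (_∘ tt Γ) (proj₂ (elim Γ F n d)) ⟩
      proj₁ (filler F sq) ∘ tt Γ                    ≡⟨ proj₂ (proj₂ (filler F sq)) ⟩
      ((n ∘ tt Γ) D.· F) ∘ proj₁ d                  ≡⟨ cong (_∘ proj₁ d) (sym (canon-· F n (tt Γ))) ⟩
      ((n D.· F) ∘ (tt Γ B.· E)) ∘ proj₁ d          ≡⟨ assoc _ _ _ ⟩
      (n D.· F) ∘ ((tt Γ B.· E) ∘ proj₁ d)          ∎)
    (begin
      B.χ E ∘ (proj₁ (urec! Γ E d) ∘ tt Γ)  ≡⟨ pullˡ (tt Γ) (proj₂ (urec! Γ E d)) ⟩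
      id ∘ tt Γ                             ≡⟨ idˡ (tt Γ) ⟩
      tt Γ                                  ≡⟨ sym (BangSections.χ-·-section (tt Γ) E d) ⟩
      B.χ E ∘ ((tt Γ B.· E) ∘ proj₁ d)      ∎)
    where
    E : Ty! 𝒞 (Γ ⊙𝟙)
    E = tri V F n
    sq : Square (tt Γ) (D.χ F)
    sq = elim-square Γ F n d

  urec!-stable : ∀ {Δ Γ} (σ : Hom Δ Γ) (E : Ty! 𝒞 (Γ ⊙𝟙)) (d : B.Section (E B.[ tt Γ ]))
                 (e : E B.[ tt Γ ] B.[ σ ] ≡ E B.[ σ ·𝟙 ] B.[ tt Δ ]) →
                 urec! Γ E d B.⟦ σ ·𝟙 ⟧ ≡ urec! Δ (E B.[ σ ·𝟙 ]) (subst B.Section e (d B.⟦ σ ⟧))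
  urec!-stable {Δ} {Γ} σ (tri V F n) d e = Section-≡ (n ∘ σ ·𝟙) F (begin
    ((n ∘ σ ·𝟙) D.· F) ∘ proj₁ (urec! Γ (tri V F n) d B.⟦ σ ·𝟙 ⟧)
      ≡⟨ reindex-· F n (urec! Γ (tri V F n) d) (σ ·𝟙) ⟩
    ((n D.· F) ∘ proj₁ (urec! Γ (tri V F n) d)) ∘ σ ·𝟙
      ≡⟨ cong (_∘ σ ·𝟙) (proj₂ (elim Γ F n d)) ⟩
    proj₁ (filler F sq) ∘ σ ·𝟙
      ≡⟨ sym (filler-∘ F sq sq' σ top-≡ refl) ⟩
    proj₁ (filler F sq')
      ≡⟨ sym (proj₂ (elim Δ F (n ∘ σ ·𝟙) d')) ⟩
    ((n ∘ σ ·𝟙) D.· F) ∘ proj₁ (urec! Δ (tri V F (n ∘ σ ·𝟙)) d') ∎)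
    where
    d' : B.Section (tri V F ((n ∘ σ ·𝟙) ∘ tt Δ))
    d' = subst B.Section e (d B.⟦ σ ⟧)
    sq : Square (tt Γ) (D.χ F)
    sq = elim-square Γ F n d
    sq' : Square (tt Δ) (D.χ F)
    sq' = elim-square Δ F (n ∘ σ ·𝟙) d'
    top-≡ : Square.top sq' ≡ Square.top sq ∘ σ
    top-≡ = trans (subst-· F _ _ e (d B.⟦ σ ⟧)) (reindex-· F (n ∘ tt Γ) d σ)

  strictlyStableUnit : B.StrictlyStableUnit (Bang-split 𝒞)
  strictlyStableUnit = record
    { one         = 𝟙
    ; tt          = tt!
    ; urec        = urec!
    ; urec-β      = urec!-β
    ; one-stable  = 𝟙-stable
    ; tt-stable   = tt-stable
    ; urec-stable = λ σ E d → urec!-stable σ E d (B.tyEq (Bang-split 𝒞) E _ σ (σ ·𝟙) _ (·𝟙-tt σ)) }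

lemma3p4p4p6 : ∀ {o h o' h'} (𝒞 : FullCompCat o h o' h') → LF 𝒞 →
    CompData.WeaklyStableUnit (toData 𝒞) →
    CompData.StrictlyStableUnit (Bang 𝒞) (Bang-split 𝒞)
lemma3p4p4p6 𝒞 lf weak = StrictUnit.strictlyStableUnit 𝒞 lf weak
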